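{- Let $G=(V,E)$ be a finite simple undirected graph and let $C_1,\ldots,C_k\subseteq V$ be edge-disjoint vertex subsets (i.e., $E(C_i)\cap E(C_j)=\emptyset$ for $i\neq j$) such that each $(C_i,E(C_i))$ is connected. Define $\mathcal{M}=\{W\subseteq E : (C_i, E(C_i)\setminus W(C_i)) \text{ is connected for every } i\}$. Then $\mathcal{M}$ is (the family of independent sets of) a matroid on $E$.
   Context: For $X\subseteq V$ and $F\subseteq E$, $F(X)=\{(u,v)\in F: u,v\in X\}$, the edges of $F$ with both endpoints in $X$. -}

module Defs where

open import Data.Nat using (ℕ; _<_)
open import Data.Fin using (Fin)
open import Data.Fin.Subset using (Subset; _∈_; _∉_; _⊆_; _∩_; _∪_; ∁; ⁅_⁆; ∣_∣; ⊥; Empty)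
open import Data.Bool using (_∧_)
open import Data.Vec using (tabulate; lookup)
open import Data.Product using (Σ; ∃; _×_; _,_; proj₁; proj₂)
open import Data.Sum using (_⊎_)
open import Relation.Binary.PropositionalEquality using (_≡_; _≢_)
open import Relation.Nullary using (¬_)

-- A finite simple undirected graph with vertex set Fin n and edge set Fin m.
-- Edge e has (unordered) endpoints  proj₁ (ends e)  and  proj₂ (ends e).
record SimpleGraph (n m : ℕ) : Set where
  field
    ends    : Fin m → Fin n × Fin n
    noLoops : ∀ e → proj₁ (ends e) ≢ proj₂ (ends e)
    noMulti : ∀ e f → e ≢ f →
              ¬ ((proj₁ (ends e) ≡ proj₁ (ends f) × proj₂ (ends e) ≡ proj₂ (ends f))
               ⊎ (proj₁ (ends e) ≡ proj₂ (ends f) × proj₂ (ends e) ≡ proj₁ (ends f)))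

module _ {n m : ℕ} (G : SimpleGraph n m) where
  open SimpleGraph G

  -- E(X) for X ⊆ V: edges of E with both endpoints in X.
  -- For F ⊆ E, F(X) = F ∩ E(X).
  E[_] : Subset n → Subset m
  E[ X ] = tabulate (λ e → lookup X (proj₁ (ends e)) ∧ lookup X (proj₂ (ends e)))

  data Reach (F : Subset m) : Fin n → Fin n → Set where
    here : ∀ {u} → Reach F u u
    step : ∀ {u w v} (e : Fin m) → e ∈ F →
           ((proj₁ (ends e) ≡ u × proj₂ (ends e) ≡ w) ⊎ (proj₂ (ends e) ≡ u × proj₁ (ends e) ≡ w)) →
           Reach F w v → Reach F u v

  Connected : Subset n → Subset m → Set
  Connected X F = (∃ λ v → v ∈ X) × (∀ u v → u ∈ X → v ∈ X → Reach F u v)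

record IsMatroid (m : ℕ) (I : Subset m → Set) : Set where
  field
    empty-indep : I ⊥
    hereditary  : ∀ A B → B ⊆ A → I A → I B
    exchange    : ∀ A B → I A → I B → ∣ A ∣ < ∣ B ∣ →
                  ∃ λ e → e ∈ B × e ∉ A × I (A ∪ ⁅ e ⁆)

module Submission where

-- The empty set
-- and closure under subsets are immediate; exchange is a component count.
-- Regard the pieces as one disjoint union, and bound the number of
-- components of a subgraph F from below by families of vertices lying in
-- pairwise different F-components.  Two general bounds hold:
--   * if F ∪ T spans every piece, F has at most |T| + k components
--     (each edge added merges at most two components);
--   * deleting from H a set S of bridges leaves at least |S| + k
--     components (each bridge deleted splits one).
-- If no element of B ─ A can be added to the independent set A, all of them
-- are bridges of ∁ A; both bounds applied to ∁ A ─ (B ─ A), which together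
-- with A ─ B contains ∁ B, give |B ─ A| ≤ |A ─ B|, hence |B| ≤ |A|.
-- Reachability is decidable, so a failure of exchange is found constructively.

open import Defs
open import Data.Nat using (ℕ; zero; suc; _+_; _≤_; _<_; z≤n; s≤s)
open import Data.Nat.Properties using (≤-trans; +-suc; +-monoʳ-≤; +-monoˡ-≤; m≤n+m; ≤-refl; <⇒≱; +-cancelʳ-≤; module ≤-Reasoning)
open import Data.Fin using (Fin; punchIn)
open import Data.Fin.Properties using (any?; all?; ¬∀⟶∃¬; injective⇒≤; punchIn-injective; punchInᵢ≢i) renaming (_≟_ to _≟F_)
open import Data.Fin.Subset using (Subset; _∈_; _∉_; _⊆_; _⊂_; _⊃_; Empty; Nonempty; _∩_; _∪_; _─_; _-_; ∁; ⁅_⁆; ∣_∣; inside; outside)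
open import Data.Fin.Subset.Properties using (_∈?_; x∈p∩q⁺; x∈p∩q⁻; x∈p∪q⁺; x∈p∪q⁻; x∈⁅x⁆; x∈⁅y⁆⇒x≡y; p⊆p∪q; p─⊥≡p; p─q⊆p; ∣p─q∣≤∣p∣; x∈p⇒p-x⊂p; nonempty?; Empty-unique; ∉⊥; x∉p⇒x∈∁p; x∈∁p⇒x∉p; ∣⊥∣≡0; x∈p∧x∉q⇒x∈p─q; x∈p∧x≢y⇒x∈p-y)
open import Data.Fin.Subset.Induction using (Acc; acc; ⊂-wellFounded; ⊃-wellFounded)
open import Function using (_∘_)
open import Data.Vec using (_∷_; []; here; there; lookup)
open import Data.Vec.Properties using (lookup∘tabulate; []=⇒lookup; lookup⇒[]=)
open import Data.Bool using (_∧_; true)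
open import Data.Bool.Properties using (∧-conicalˡ; ∧-conicalʳ)
open import Data.Vec.Functional using () renaming (_∷_ to _∷ᶠ_)
open import Data.Product using (Σ; ∃; _×_; _,_; proj₁; proj₂)
open import Data.Sum using (_⊎_; inj₁; inj₂; [_,_])
open import Data.Empty using (⊥)
open import Relation.Nullary using (¬_; Dec; yes; no; contradiction)
open import Relation.Nullary.Decidable using (_×-dec_; _⊎-dec_; _→-dec_; ¬?; decidable-stable; map′)
open import Relation.Binary.PropositionalEquality using (_≡_; _≢_; refl; sym; trans; cong; subst)

∣p∣≡1+∣p-x∣ : ∀ {n} {x : Fin n} (p : Subset n) → x ∈ p → ∣ p ∣ ≡ suc ∣ p - x ∣
∣p∣≡1+∣p-x∣ {x = Fin.zero} (inside ∷ p) here = cong (λ q → suc ∣ q ∣) (sym (p─⊥≡p p))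
∣p∣≡1+∣p-x∣ {x = Fin.suc x} (inside ∷ p) (there x∈p) = cong suc (∣p∣≡1+∣p-x∣ p x∈p)
∣p∣≡1+∣p-x∣ {x = Fin.suc x} (outside ∷ p) (there x∈p) = ∣p∣≡1+∣p-x∣ p x∈p

x∈p─q⇒x∉q : ∀ {n} (p q : Subset n) {x} → x ∈ p ─ q → x ∉ q
x∈p─q⇒x∉q (_ ∷ p) (inside ∷ q) {Fin.zero} ()
x∈p─q⇒x∉q (_ ∷ p) (outside ∷ q) {Fin.zero} _ ()
x∈p─q⇒x∉q (_ ∷ p) (_ ∷ q) {Fin.suc x} (there x∈p─q) (there x∈q) = x∈p─q⇒x∉q p q x∈p─q x∈q

-- Both sides count the elements of A ∪ B, those of A ∩ B twice.
∣B∣+∣A─B∣≡∣A∣+∣B─A∣ : ∀ {n} (A B : Subset n) → ∣ B ∣ + ∣ A ─ B ∣ ≡ ∣ A ∣ + ∣ B ─ A ∣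
∣B∣+∣A─B∣≡∣A∣+∣B─A∣ [] [] = refl
∣B∣+∣A─B∣≡∣A∣+∣B─A∣ (inside ∷ A) (inside ∷ B) = cong suc (∣B∣+∣A─B∣≡∣A∣+∣B─A∣ A B)
∣B∣+∣A─B∣≡∣A∣+∣B─A∣ (inside ∷ A) (outside ∷ B) = trans (+-suc _ _) (cong suc (∣B∣+∣A─B∣≡∣A∣+∣B─A∣ A B))
∣B∣+∣A─B∣≡∣A∣+∣B─A∣ (outside ∷ A) (inside ∷ B) = trans (cong suc (∣B∣+∣A─B∣≡∣A∣+∣B─A∣ A B)) (sym (+-suc _ _))
∣B∣+∣A─B∣≡∣A∣+∣B─A∣ (outside ∷ A) (outside ∷ B) = ∣B∣+∣A─B∣≡∣A∣+∣B─A∣ A B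

∣B─A∣≤∣A─B∣⇒∣B∣≤∣A∣ : ∀ {n} (A B : Subset n) → ∣ B ─ A ∣ ≤ ∣ A ─ B ∣ → ∣ B ∣ ≤ ∣ A ∣
∣B─A∣≤∣A─B∣⇒∣B∣≤∣A∣ A B le = +-cancelʳ-≤ (∣ A ─ B ∣) (∣ B ∣) (∣ A ∣) (begin
  ∣ B ∣ + ∣ A ─ B ∣  ≡⟨ ∣B∣+∣A─B∣≡∣A∣+∣B─A∣ A B ⟩
  ∣ A ∣ + ∣ B ─ A ∣  ≤⟨ +-monoʳ-≤ (∣ A ∣) le ⟩
  ∣ A ∣ + ∣ A ─ B ∣  ∎)
  where open ≤-Reasoning

∩-monoˡ-⊆ : ∀ {n} {F F' : Subset n} X → F ⊆ F' → F ∩ X ⊆ F' ∩ X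
∩-monoˡ-⊆ {F = F} X F⊆F' e∈F∩X with x∈p∩q⁻ F X e∈F∩X
... | e∈F , e∈X = x∈p∩q⁺ (F⊆F' e∈F , e∈X)

─-antiʳ-⊆ : ∀ {n} (p : Subset n) {q r : Subset n} → r ⊆ q → p ─ q ⊆ p ─ r
─-antiʳ-⊆ p {q} r⊆q x∈p─q = x∈p∧x∉q⇒x∈p─q (p─q⊆p p q x∈p─q) (λ x∈r → x∈p─q⇒x∉q p q x∈p─q (r⊆q x∈r))

⁅x⁆⊆p : ∀ {n} {p : Subset n} {x} → x ∈ p → ⁅ x ⁆ ⊆ p
⁅x⁆⊆p {p = p} {x} x∈p y∈⁅x⁆ = subst (_∈ p) (sym (x∈⁅y⁆⇒x≡y x y∈⁅x⁆)) x∈p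

x∉p-x : ∀ {n} (p : Subset n) x → x ∉ p - x
x∉p-x p x x∈p-x = x∈p─q⇒x∉q p ⁅ x ⁆ x∈p-x (x∈⁅x⁆ x)

∪⁅⁆-drop : ∀ {n} {F : Subset n} {t e} → e ∈ F ∪ ⁅ t ⁆ → e ≢ t → e ∈ F
∪⁅⁆-drop {F = F} {t} e∈F+t e≢t with x∈p∪q⁻ F ⁅ t ⁆ e∈F+t
... | inj₁ e∈F = e∈F
... | inj₂ e∈⁅t⁆ = contradiction (x∈⁅y⁆⇒x≡y t e∈⁅t⁆) e≢t

move-⊆ : ∀ {n} (F T : Subset n) t → F ∪ T ⊆ (F ∪ ⁅ t ⁆) ∪ (T - t)
move-⊆ F T t {e} e∈F∪T with x∈p∪q⁻ F T e∈F∪T | e ≟F t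
... | inj₁ e∈F | _ = x∈p∪q⁺ (inj₁ (p⊆p∪q ⁅ t ⁆ e∈F))
... | inj₂ _ | yes refl = x∈p∪q⁺ (inj₁ (x∈p∪q⁺ (inj₂ (x∈⁅x⁆ t))))
... | inj₂ e∈T | no e≢t = x∈p∪q⁺ (inj₂ (x∈p∧x≢y⇒x∈p-y e∈T e≢t))

∪-identityʳ-⊆ : ∀ {n} (F T : Subset n) → Empty T → F ∪ T ⊆ F
∪-identityʳ-⊆ F T T-empty {e} e∈F∪T with x∈p∪q⁻ F T e∈F∪T
... | inj₁ e∈F = e∈F
... | inj₂ e∈T = contradiction (e , e∈T) T-empty

module Walks {n m : ℕ} (G : SimpleGraph n m) where
  open SimpleGraph G

  src tgt : Fin m → Fin n
  src e = proj₁ (ends e)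
  tgt e = proj₂ (ends e)

  E[]-ends : ∀ {X e} → e ∈ E[_] G X → src e ∈ X × tgt e ∈ X
  E[]-ends {X} {e} e∈EX = lookup⇒[]= (src e) X (∧-conicalˡ _ _ both) , lookup⇒[]= (tgt e) X (∧-conicalʳ _ _ both)
    where
    both : lookup X (src e) ∧ lookup X (tgt e) ≡ true
    both = trans (sym (lookup∘tabulate _ e)) ([]=⇒lookup e∈EX)

  infix 4 _~[_]_
  _~[_]_ : Fin n → Subset m → Fin n → Set
  u ~[ F ] v = Reach G F u v

  ~-trans : ∀ {F u w v} → u ~[ F ] w → w ~[ F ] v → u ~[ F ] v
  ~-trans here q = q
  ~-trans (step e e∈F inc r) q = step e e∈F inc (~-trans r q)

  along : ∀ {F} e → e ∈ F → src e ~[ F ] tgt e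
  along e e∈F = step e e∈F (inj₁ (refl , refl)) here

  against : ∀ {F} e → e ∈ F → tgt e ~[ F ] src e
  against e e∈F = step e e∈F (inj₂ (refl , refl)) here

  ~-sym : ∀ {F u v} → u ~[ F ] v → v ~[ F ] u
  ~-sym here = here
  ~-sym (step e e∈F (inj₁ (refl , refl)) r) = ~-trans (~-sym r) (against e e∈F)
  ~-sym (step e e∈F (inj₂ (refl , refl)) r) = ~-trans (~-sym r) (along e e∈F)

  ~-mono : ∀ {F F' u v} → F ⊆ F' → u ~[ F ] v → u ~[ F' ] v
  ~-mono F⊆F' here = here
  ~-mono F⊆F' (step e e∈F inc r) = step e (F⊆F' e∈F) inc (~-mono F⊆F' r)

  connected-mono : ∀ {X F F'} → F ⊆ F' → Connected G X F → Connected G X F'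
  connected-mono F⊆F' (x , joined) = x , λ u v u∈X v∈X → ~-mono F⊆F' (joined u v u∈X v∈X)

  Via : Subset m → Fin m → Fin n → Fin n → Set
  Via F t u v = (u ~[ F ] src t × tgt t ~[ F ] v) ⊎ (u ~[ F ] tgt t × src t ~[ F ] v)

  split : ∀ {F F₀ u v} t → (∀ {e} → e ∈ F → e ≢ t → e ∈ F₀) →
          u ~[ F ] v → u ~[ F₀ ] v ⊎ (t ∈ F × Via F₀ t u v)
  split t F⊆F₀+t here = inj₁ here
  split t F⊆F₀+t (step e e∈F inc r) with e ≟F t | split t F⊆F₀+t r
  ... | no e≢t | inj₁ q = inj₁ (step e (F⊆F₀+t e∈F e≢t) inc q)
  ... | no e≢t | inj₂ (t∈F , inj₁ (a , b)) = inj₂ (t∈F , inj₁ (step e (F⊆F₀+t e∈F e≢t) inc a , b))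
  ... | no e≢t | inj₂ (t∈F , inj₂ (a , b)) = inj₂ (t∈F , inj₂ (step e (F⊆F₀+t e∈F e≢t) inc a , b))
  split t F⊆F₀+t (step t t∈F (inj₁ (refl , refl)) r) | yes refl | inj₁ q = inj₂ (t∈F , inj₁ (here , q))
  split t F⊆F₀+t (step t t∈F (inj₁ (refl , refl)) r) | yes refl | inj₂ (_ , inj₁ (_ , b)) = inj₂ (t∈F , inj₁ (here , b))
  split t F⊆F₀+t (step t t∈F (inj₁ (refl , refl)) r) | yes refl | inj₂ (_ , inj₂ (_ , b)) = inj₁ b
  split t F⊆F₀+t (step t t∈F (inj₂ (refl , refl)) r) | yes refl | inj₁ q = inj₂ (t∈F , inj₂ (here , q))
  split t F⊆F₀+t (step t t∈F (inj₂ (refl , refl)) r) | yes refl | inj₂ (_ , inj₁ (_ , b)) = inj₁ b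
  split t F⊆F₀+t (step t t∈F (inj₂ (refl , refl)) r) | yes refl | inj₂ (_ , inj₂ (_ , b)) = inj₂ (t∈F , inj₂ (here , b))

  reroute : ∀ {F F' u v} t → (∀ {e} → e ∈ F → e ≢ t → e ∈ F') →
            src t ~[ F' ] tgt t → u ~[ F ] v → u ~[ F' ] v
  reroute t F⊆F'+t ends-joined r with split t F⊆F'+t r
  ... | inj₁ r' = r'
  ... | inj₂ (_ , inj₁ (a , b)) = ~-trans a (~-trans ends-joined b)
  ... | inj₂ (_ , inj₂ (a , b)) = ~-trans a (~-trans (~-sym ends-joined) b)

  Closed : Subset m → Subset n → Set
  Closed F X = ∀ {e} → e ∈ F → (src e ∈ X → tgt e ∈ X) × (tgt e ∈ X → src e ∈ X)

  closed-reach : ∀ {F X u v} → Closed F X → u ~[ F ] v → u ∈ X → v ∈ X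
  closed-reach cl here u∈X = u∈X
  closed-reach cl (step e e∈F (inj₁ (refl , refl)) r) u∈X = closed-reach cl r (proj₁ (cl e∈F) u∈X)
  closed-reach cl (step e e∈F (inj₂ (refl , refl)) r) u∈X = closed-reach cl r (proj₂ (cl e∈F) u∈X)

  Leaves : Subset m → Subset n → Fin m → Set
  Leaves F X e = e ∈ F × ((src e ∈ X × tgt e ∉ X) ⊎ (tgt e ∈ X × src e ∉ X))

  leaves? : ∀ F X e → Dec (Leaves F X e)
  leaves? F X e = e ∈? F ×-dec ((src e ∈? X ×-dec ¬? (tgt e ∈? X)) ⊎-dec (tgt e ∈? X ×-dec ¬? (src e ∈? X)))

  unleft⇒closed : ∀ {F X} → (∀ e → ¬ Leaves F X e) → Closed F X
  unleft⇒closed {F} {X} unleft {e} e∈F =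
      (λ s∈X → decidable-stable (tgt e ∈? X) (λ t∉X → unleft e (e∈F , inj₁ (s∈X , t∉X))))
    , (λ t∈X → decidable-stable (src e ∈? X) (λ s∉X → unleft e (e∈F , inj₂ (t∈X , s∉X))))

  leaving-step : ∀ {F X e} → Leaves F X e → ∃ λ w → w ∉ X × ∃ λ x → x ∈ X × x ~[ F ] w
  leaving-step {e = e} (e∈F , inj₁ (s∈X , t∉X)) = tgt e , t∉X , src e , s∈X , along e e∈F
  leaving-step {e = e} (e∈F , inj₂ (t∈X , s∉X)) = src e , s∉X , tgt e , t∈X , against e e∈F

  -- Reachability is decidable: grow a set X of vertices reachable from u
  -- until it contains v or is closed under F (well-founded as X only grows).
  reach? : ∀ F u v → Dec (u ~[ F ] v)
  reach? F u v = search ⁅ u ⁆ (⊃-wellFounded ⁅ u ⁆) (x∈⁅x⁆ u) from-u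
    where
    from-u : ∀ {w} → w ∈ ⁅ u ⁆ → u ~[ F ] w
    from-u w∈⁅u⁆ = subst (u ~[ F ]_) (sym (x∈⁅y⁆⇒x≡y u w∈⁅u⁆)) here

    search : ∀ X → Acc _⊃_ X → u ∈ X → (∀ {w} → w ∈ X → u ~[ F ] w) → Dec (u ~[ F ] v)
    search X (acc larger) u∈X reached with v ∈? X | any? (leaves? F X)
    ... | yes v∈X | _ = yes (reached v∈X)
    ... | no v∉X | no unleft = no (λ u~v → v∉X (closed-reach (unleft⇒closed (λ e l → unleft (e , l))) u~v u∈X))
    ... | no _ | yes (_ , leaving) with leaving-step leaving
    ...   | w , w∉X , x , x∈X , x~w =
            search (X ∪ ⁅ w ⁆) (larger X⊂X+w) (p⊆p∪q ⁅ w ⁆ u∈X) reached'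
      where
      X⊂X+w : (X ∪ ⁅ w ⁆) ⊃ X
      X⊂X+w = p⊆p∪q ⁅ w ⁆ , w , x∈p∪q⁺ (inj₂ (x∈⁅x⁆ w)) , w∉X

      reached' : ∀ {z} → z ∈ X ∪ ⁅ w ⁆ → u ~[ F ] z
      reached' z∈ with x∈p∪q⁻ X ⁅ w ⁆ z∈
      ... | inj₁ z∈X = reached z∈X
      ... | inj₂ z∈⁅w⁆ = subst (u ~[ F ]_) (sym (x∈⁅y⁆⇒x≡y w z∈⁅w⁆)) (~-trans (reached x∈X) x~w)

  connected? : ∀ X F → Dec (Connected G X F)
  connected? X F = any? (_∈? X) ×-dec all? λ u → all? λ v → (u ∈? X) →-dec (v ∈? X) →-dec reach? F u v

-- The pieces (C i, E(C i)) of the theorem, viewed together as one disjoint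
-- union whose vertices are pairs (i , u) with u ∈ C i.  Components of
-- subgraphs F of this union are counted from below by families of vertices
-- in pairwise different components ("separated" families).
module Components {n m k : ℕ} (G : SimpleGraph n m) (C : Fin k → Subset n)
  (disjoint : ∀ i j → i ≢ j → Empty (E[_] G (C i) ∩ E[_] G (C j))) where
  open Walks G

  E : Fin k → Subset m
  E i = E[_] G (C i)

  piece-unique : ∀ {t i j} → t ∈ E i → t ∈ E j → i ≡ j
  piece-unique {t} {i} {j} t∈Ei t∈Ej with i ≟F j
  ... | yes i≡j = i≡j
  ... | no i≢j = contradiction (t , x∈p∩q⁺ (t∈Ei , t∈Ej)) (disjoint i j i≢j)

  Vertex : Set
  Vertex = Fin k × Fin n

  OnPiece : Vertex → Set
  OnPiece p = proj₂ p ∈ C (proj₁ p)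

  Link : Subset m → Vertex → Vertex → Set
  Link F p q = proj₁ p ≡ proj₁ q × proj₂ p ~[ F ∩ E (proj₁ p) ] proj₂ q

  link-sym : ∀ {F i j u v} → Link F (i , u) (j , v) → Link F (j , v) (i , u)
  link-sym (refl , r) = refl , ~-sym r

  link-trans : ∀ {F i j l u v w} → Link F (i , u) (j , v) → Link F (j , v) (l , w) → Link F (i , u) (l , w)
  link-trans (refl , r) (refl , r') = refl , ~-trans r r'

  link-mono : ∀ {F F' i j u v} → F ⊆ F' → Link F (i , u) (j , v) → Link F' (i , u) (j , v)
  link-mono {i = i} F⊆F' (refl , r) = refl , ~-mono (∩-monoˡ-⊆ (E i) F⊆F') r

  link? : ∀ F p q → Dec (Link F p q)
  link? F (i , u) (j , v) with i ≟F j
  ... | no i≢j = no (λ l → i≢j (proj₁ l))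
  ... | yes refl = map′ (refl ,_) proj₂ (reach? (F ∩ E i) u v)

  Spanning : Subset m → Set
  Spanning F = ∀ i u v → u ∈ C i → v ∈ C i → u ~[ F ∩ E i ] v

  spanning-mono : ∀ {F F'} → F ⊆ F' → Spanning F → Spanning F'
  spanning-mono F⊆F' span i u v u∈ v∈ = ~-mono (∩-monoˡ-⊆ (E i) F⊆F') (span i u v u∈ v∈)

  record Separated {K : ℕ} (F : Subset m) (D : Fin K → Vertex) : Set where
    field
      on-piece : ∀ a → OnPiece (D a)
      apart    : ∀ a b → a ≢ b → ¬ Link F (D a) (D b)
  open Separated

  AtLeast : Subset m → ℕ → Set
  AtLeast F N = ∃ λ K → Σ (Fin K → Vertex) λ D → Separated F D × N ≤ K

  separated-anti : ∀ {F F' K} {D : Fin K → Vertex} → F ⊆ F' → Separated F' D → Separated F D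
  separated-anti F⊆F' sep = record
    { on-piece = on-piece sep
    ; apart    = λ a b a≢b l → apart sep a b a≢b (link-mono F⊆F' l) }

  separated-cons : ∀ {F K} {D : Fin K → Vertex} {w} → Separated F D → OnPiece w →
                   (∀ j → ¬ Link F w (D j)) → Separated F (w ∷ᶠ D)
  separated-cons {F} {D = D} {w} sep w-on w-free = record { on-piece = on ; apart = ap }
    where
    on : ∀ a → OnPiece ((w ∷ᶠ D) a)
    on Fin.zero = w-on
    on (Fin.suc a) = on-piece sep a

    ap : ∀ a b → a ≢ b → ¬ Link F ((w ∷ᶠ D) a) ((w ∷ᶠ D) b)
    ap Fin.zero Fin.zero a≢b _ = a≢b refl
    ap Fin.zero (Fin.suc b) _ l = w-free b l
    ap (Fin.suc a) Fin.zero _ l = w-free a (link-sym l)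
    ap (Fin.suc a) (Fin.suc b) a≢b l = apart sep a b (λ a≡b → a≢b (cong Fin.suc a≡b)) l

  -- When F spans every piece, a separated family meets each piece at most
  -- once, so it has at most k members.
  spanning⇒≤k : ∀ {F K} {D : Fin K → Vertex} → Spanning F → Separated F D → K ≤ k
  spanning⇒≤k {D = D} span sep = injective⇒≤ piece-injective
    where
    piece-injective : ∀ {a b} → proj₁ (D a) ≡ proj₁ (D b) → a ≡ b
    piece-injective {a} {b} same with a ≟F b
    ... | yes a≡b = a≡b
    ... | no a≢b = contradiction (same , span (proj₁ (D a)) (proj₂ (D a)) (proj₂ (D b)) (on-piece sep a) b-on-a's-piece) (apart sep a b a≢b)
      where
      b-on-a's-piece : proj₂ (D b) ∈ C (proj₁ (D a))
      b-on-a's-piece = subst (λ i → proj₂ (D b) ∈ C i) (sym same) (on-piece sep b)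

  LinkVia : Subset m → Fin m → Vertex → Vertex → Set
  LinkVia F t p q = ∃ λ i → t ∈ E i ×
    ((Link F p (i , src t) × Link F (i , tgt t) q) ⊎ (Link F p (i , tgt t) × Link F (i , src t) q))

  link-split : ∀ {F t i j u v} → Link (F ∪ ⁅ t ⁆) (i , u) (j , v) →
               Link F (i , u) (j , v) ⊎ LinkVia F t (i , u) (j , v)
  link-split {F} {t} {i} (refl , r) with split {F₀ = F ∩ E i} t drop-t r
    where
    drop-t : ∀ {e} → e ∈ (F ∪ ⁅ t ⁆) ∩ E i → e ≢ t → e ∈ F ∩ E i
    drop-t e∈ e≢t with x∈p∩q⁻ (F ∪ ⁅ t ⁆) (E i) e∈
    ... | e∈F+t , e∈Ei = x∈p∩q⁺ (∪⁅⁆-drop e∈F+t e≢t , e∈Ei)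
  ... | inj₁ r' = inj₁ (refl , r')
  ... | inj₂ (t∈ , inj₁ (a , b)) = inj₂ (i , proj₂ (x∈p∩q⁻ _ (E i) t∈) , inj₁ ((refl , a) , (refl , b)))
  ... | inj₂ (t∈ , inj₂ (a , b)) = inj₂ (i , proj₂ (x∈p∩q⁻ _ (E i) t∈) , inj₂ ((refl , a) , (refl , b)))

  -- Adding one edge to F merges at most two components: if it links D a
  -- with D b, then the family without D b is still separated.
  merge-once : ∀ {F t K} {D : Fin K → Vertex} → Separated F D →
               ∀ {a b} → a ≢ b → Link (F ∪ ⁅ t ⁆) (D a) (D b) →
               ∀ {c d} → c ≢ d → c ≢ b → d ≢ b → ¬ Link (F ∪ ⁅ t ⁆) (D c) (D d)
  merge-once {F} {t} {D = D} sep {a} {b} a≢b lab {c} {d} c≢d c≢b d≢b lcd with link-split lab | link-split lcd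
  ... | inj₁ l | _ = apart sep a b a≢b l
  ... | inj₂ _ | inj₁ l = apart sep c d c≢d l
  ... | inj₂ (i , t∈Ei , ab) | inj₂ (i' , t∈Ei' , cd) with piece-unique t∈Ei t∈Ei'
  ... | refl = b-meets-c-or-d (b-at-an-end ab) cd
    where
    b-at-an-end : (Link F (D a) (i , src t) × Link F (i , tgt t) (D b)) ⊎ (Link F (D a) (i , tgt t) × Link F (i , src t) (D b)) →
                  Link F (D b) (i , src t) ⊎ Link F (D b) (i , tgt t)
    b-at-an-end (inj₁ (_ , tb)) = inj₂ (link-sym tb)
    b-at-an-end (inj₂ (_ , sb)) = inj₁ (link-sym sb)

    b-meets-c-or-d : Link F (D b) (i , src t) ⊎ Link F (D b) (i , tgt t) →
                     (Link F (D c) (i , src t) × Link F (i , tgt t) (D d)) ⊎ (Link F (D c) (i , tgt t) × Link F (i , src t) (D d)) →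
                     ⊥
    b-meets-c-or-d (inj₁ bs) (inj₁ (cs , _)) = apart sep b c (λ b≡c → c≢b (sym b≡c)) (link-trans bs (link-sym cs))
    b-meets-c-or-d (inj₁ bs) (inj₂ (_ , sd)) = apart sep b d (λ b≡d → d≢b (sym b≡d)) (link-trans bs sd)
    b-meets-c-or-d (inj₂ bt) (inj₁ (_ , td)) = apart sep b d (λ b≡d → d≢b (sym b≡d)) (link-trans bt td)
    b-meets-c-or-d (inj₂ bt) (inj₂ (ct , _)) = apart sep b c (λ b≡c → c≢b (sym b≡c)) (link-trans bt (link-sym ct))

  -- If F ∪ T spans every piece, F has at most |T| + k components: add the
  -- edges of T to F one at a time, each merging at most two components.
  spanning-bound : ∀ {F K} {D : Fin K → Vertex} T → Acc _⊂_ T → Spanning (F ∪ T) → Separated F D → K ≤ ∣ T ∣ + k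
  spanning-bound {K = zero} _ _ _ _ = z≤n
  spanning-bound {F} {suc K} {D} T (acc smaller) span sep with nonempty? T
  ... | no T-empty = ≤-trans (spanning⇒≤k (spanning-mono (∪-identityʳ-⊆ F T T-empty) span) sep) (m≤n+m k ∣ T ∣)
  ... | yes (t , t∈T) = by-cases (any? (λ a → any? (λ b → ¬? (a ≟F b) ×-dec link? (F ∪ ⁅ t ⁆) (D a) (D b))))
    where
    open ≤-Reasoning
    IH : ∀ {K'} {D' : Fin K' → Vertex} → Separated (F ∪ ⁅ t ⁆) D' → K' ≤ ∣ T - t ∣ + k
    IH = spanning-bound (T - t) (smaller (x∈p⇒p-x⊂p t∈T)) (spanning-mono (move-⊆ F T t) span)

    by-cases : Dec (∃ λ a → ∃ λ b → a ≢ b × Link (F ∪ ⁅ t ⁆) (D a) (D b)) → suc K ≤ ∣ T ∣ + k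
    by-cases (no unlinked) = begin
      suc K          ≤⟨ IH (record { on-piece = on-piece sep ; apart = λ a b a≢b l → unlinked (a , b , a≢b , l) }) ⟩
      ∣ T - t ∣ + k  ≤⟨ +-monoˡ-≤ k (∣p─q∣≤∣p∣ T ⁅ t ⁆) ⟩
      ∣ T ∣ + k      ∎
    by-cases (yes (a , b , a≢b , linked)) = begin
      suc K              ≤⟨ s≤s (IH without-b) ⟩
      suc ∣ T - t ∣ + k  ≡⟨ cong (_+ k) (sym (∣p∣≡1+∣p-x∣ T t∈T)) ⟩
      ∣ T ∣ + k          ∎
      where
      without-b : Separated (F ∪ ⁅ t ⁆) (D ∘ punchIn b)
      without-b = record
        { on-piece = on-piece sep ∘ punchIn b
        ; apart    = λ c d c≢d → merge-once sep a≢b linked (c≢d ∘ punchIn-injective b c d) (punchInᵢ≢i b c) (punchInᵢ≢i b d) }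

  one-per-piece : (∀ i → Nonempty (C i)) → ∀ F → AtLeast F k
  one-per-piece roots F = k , (λ i → i , proj₁ (roots i)) , sep , ≤-refl
    where
    sep : Separated F (λ i → i , proj₁ (roots i))
    sep = record { on-piece = λ i → proj₂ (roots i) ; apart = λ i j i≢j l → i≢j (proj₁ l) }

  Bridges : Subset m → Subset m → Set
  Bridges H S = ∀ {s} → s ∈ S → ∃ λ i → s ∈ E i × ¬ (src s ~[ (H - s) ∩ E i ] tgt s)

  -- If the ends of an edge s of F' are not joined in F ⊆ F', then some end
  -- of s is linked in F to no member of an F'-separated family (otherwise s
  -- would link two members, or F would join the ends of s).
  free-end : ∀ {F F' K i s} {D : Fin K → Vertex} → F ⊆ F' → Separated F' D →
             s ∈ F' ∩ E i → ¬ (src s ~[ F ∩ E i ] tgt s) →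
             (∀ j → ¬ Link F (i , src s) (D j)) ⊎ (∀ j → ¬ Link F (i , tgt s) (D j))
  free-end {F} {i = i} {s} {D} F⊆F' sep s∈F' unjoined
    with any? (λ j → link? F (i , src s) (D j)) | any? (λ j → link? F (i , tgt s) (D j))
  ... | no src-free | _ = inj₁ (λ j l → src-free (j , l))
  ... | yes _ | no tgt-free = inj₂ (λ j l → tgt-free (j , l))
  ... | yes (j , src~j) | yes (j' , tgt~j') with j ≟F j'
  ...   | yes refl = contradiction (proj₂ (link-trans src~j (link-sym tgt~j'))) unjoined
  ...   | no j≢j' = contradiction (link-trans (link-sym (link-mono F⊆F' src~j))
                                    (link-trans (refl , along s s∈F') (link-mono F⊆F' tgt~j')))
                                  (apart sep j j' j≢j')

  -- Deleting from H a set S of bridges leaves at least |S| + k components: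
  -- delete them one at a time, each adding a component at a free end.
  bridge-bound : ∀ {H} S → Acc _⊂_ S → (∀ i → Nonempty (C i)) → S ⊆ H → Bridges H S → AtLeast (H ─ S) (∣ S ∣ + k)
  bridge-bound {H} S (acc smaller) roots S⊆H bridges with nonempty? S
  ... | no S-empty = subst (λ N → AtLeast (H ─ S) (N + k)) (sym ∣S∣≡0) (one-per-piece roots (H ─ S))
    where
    ∣S∣≡0 : ∣ S ∣ ≡ 0
    ∣S∣≡0 = trans (cong ∣_∣ (Empty-unique S-empty)) (∣⊥∣≡0 m)
  ... | yes (s , s∈S) with bridge-bound (S - s) (smaller (x∈p⇒p-x⊂p s∈S)) roots (S⊆H ∘ p─q⊆p S ⁅ s ⁆) (bridges ∘ p─q⊆p S ⁅ s ⁆)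
                         | bridges s∈S
  ... | K , D , sep , bound | i , s∈Ei , unjoined = extend (free-end H─S⊆H─S' sep s∈ unjoined')
    where
    H─S⊆H─S' : H ─ S ⊆ H ─ (S - s)
    H─S⊆H─S' = ─-antiʳ-⊆ H (p─q⊆p S ⁅ s ⁆)

    s∈ : s ∈ (H ─ (S - s)) ∩ E i
    s∈ = x∈p∩q⁺ (x∈p∧x∉q⇒x∈p─q (S⊆H s∈S) (x∉p-x S s) , s∈Ei)

    unjoined' : ¬ (src s ~[ (H ─ S) ∩ E i ] tgt s)
    unjoined' = unjoined ∘ ~-mono (∩-monoˡ-⊆ (E i) (─-antiʳ-⊆ H (⁅x⁆⊆p s∈S)))

    bound' : ∣ S ∣ + k ≤ suc K
    bound' = subst (λ N → N + k ≤ suc K) (sym (∣p∣≡1+∣p-x∣ S s∈S)) (s≤s bound)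

    extend : (∀ j → ¬ Link (H ─ S) (i , src s) (D j)) ⊎ (∀ j → ¬ Link (H ─ S) (i , tgt s) (D j)) → AtLeast (H ─ S) (∣ S ∣ + k)
    extend (inj₁ src-free) = suc K , _ , separated-cons (separated-anti H─S⊆H─S' sep) (proj₁ (E[]-ends s∈Ei)) src-free , bound'
    extend (inj₂ tgt-free) = suc K , _ , separated-cons (separated-anti H─S⊆H─S' sep) (proj₂ (E[]-ends s∈Ei)) tgt-free , bound'

module Deletion {n m k : ℕ} (G : SimpleGraph n m) (C : Fin k → Subset n)
  (disjoint : ∀ i j → i ≢ j → Empty (E[_] G (C i) ∩ E[_] G (C j))) where
  open Walks G
  open Components G C disjoint

  Kept : Subset m → Fin k → Subset m
  Kept W i = E i ∩ ∁ (W ∩ E i)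

  kept⁺ : ∀ {W i e} → e ∈ E i → e ∉ W → e ∈ Kept W i
  kept⁺ {W} {i} e∈Ei e∉W = x∈p∩q⁺ (e∈Ei , x∉p⇒x∈∁p (e∉W ∘ proj₁ ∘ x∈p∩q⁻ W (E i)))

  kept⁻ : ∀ {W i e} → e ∈ Kept W i → e ∈ E i × e ∉ W
  kept⁻ {W} {i} e∈Kept with x∈p∩q⁻ (E i) _ e∈Kept
  ... | e∈Ei , e∈∁ = e∈Ei , λ e∈W → x∈∁p⇒x∉p e∈∁ (x∈p∩q⁺ (e∈W , e∈Ei))

  Indep : Subset m → Set
  Indep W = ∀ i → Connected G (C i) (Kept W i)

  indep? : ∀ W → Dec (Indep W)
  indep? W = all? (λ i → connected? (C i) (Kept W i))

  indep-anti : ∀ {A B} → B ⊆ A → Indep A → Indep B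
  indep-anti {A} {B} B⊆A indep-A i = connected-mono kept-more (indep-A i)
    where
    kept-more : ∀ {e} → e ∈ Kept A i → e ∈ Kept B i
    kept-more e∈ = kept⁺ (proj₁ (kept⁻ e∈)) (proj₂ (kept⁻ e∈) ∘ B⊆A)

  indep⇒spanning : ∀ {W} → Indep W → Spanning (∁ W)
  indep⇒spanning {W} indep i u v u∈ v∈ = ~-mono kept⊆ (proj₂ (indep i) u v u∈ v∈)
    where
    kept⊆ : ∀ {e} → e ∈ Kept W i → e ∈ ∁ W ∩ E i
    kept⊆ e∈ = x∈p∩q⁺ (x∉p⇒x∈∁p (proj₂ (kept⁻ e∈)) , proj₁ (kept⁻ e∈))

  -- s may be added to an independent A unless it is a bridge of ∁ A in its
  -- piece: walks through s are rerouted around it.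
  add-nonbridge : ∀ {A s} → Indep A → (∀ i → s ∈ E i → src s ~[ (∁ A - s) ∩ E i ] tgt s) → Indep (A ∪ ⁅ s ⁆)
  add-nonbridge {A} {s} indep-A detour i = proj₁ (indep-A i) , λ u v u∈ v∈ → reroute-in (proj₂ (indep-A i) u v u∈ v∈)
    where
    keep : ∀ {e} → e ∈ Kept A i → e ≢ s → e ∈ Kept (A ∪ ⁅ s ⁆) i
    keep e∈ e≢s = kept⁺ (proj₁ (kept⁻ e∈)) (λ e∈A+s → proj₂ (kept⁻ e∈) (∪⁅⁆-drop e∈A+s e≢s))

    detour-kept : ∀ {e} → e ∈ (∁ A - s) ∩ E i → e ∈ Kept (A ∪ ⁅ s ⁆) i
    detour-kept e∈ with x∈p∩q⁻ (∁ A - s) (E i) e∈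
    ... | e∈∁A-s , e∈Ei = kept⁺ e∈Ei λ e∈A+s → [ x∈∁p⇒x∉p (p─q⊆p (∁ A) ⁅ s ⁆ e∈∁A-s) , x∈p─q⇒x∉q (∁ A) ⁅ s ⁆ e∈∁A-s ]
                                                  (x∈p∪q⁻ A ⁅ s ⁆ e∈A+s)

    reroute-in : ∀ {u v} → u ~[ Kept A i ] v → u ~[ Kept (A ∪ ⁅ s ⁆) i ] v
    reroute-in with s ∈? E i
    ... | yes s∈Ei = reroute s keep (~-mono detour-kept (detour i s∈Ei))
    ... | no s∉Ei = ~-mono λ e∈ → keep e∈ (λ e≡s → s∉Ei (subst (_∈ E i) e≡s (proj₁ (kept⁻ e∈))))

  unaddable⇒bridges : ∀ {A B} → Indep A → (∀ s → s ∈ B ─ A → ¬ Indep (A ∪ ⁅ s ⁆)) → Bridges (∁ A) (B ─ A)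
  unaddable⇒bridges {A} indep-A unaddable {s} s∈B─A
    with ¬∀⟶∃¬ k NotBridge (λ i → (s ∈? E i) →-dec reach? _ _ _) (unaddable s s∈B─A ∘ add-nonbridge indep-A)
    where
    NotBridge : Fin k → Set
    NotBridge i = s ∈ E i → src s ~[ (∁ A - s) ∩ E i ] tgt s
  ... | i , bridge with s ∈? E i
  ...   | yes s∈Ei = i , s∈Ei , λ r → bridge (λ _ → r)
  ...   | no s∉Ei = contradiction (λ s∈Ei → contradiction s∈Ei s∉Ei) bridge

  -- The counting argument: with S = B ─ A and T = A ─ B, the graph
  -- ∁ A ─ S has at least |S| + k components (S consists of bridges), and at
  -- most |T| + k (adding T yields ∁ B, which spans).  Hence |S| ≤ |T|.
  unaddable⇒≤ : ∀ {A B} → Indep A → Indep B → (∀ s → s ∈ B ─ A → ¬ Indep (A ∪ ⁅ s ⁆)) → ∣ B ∣ ≤ ∣ A ∣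
  unaddable⇒≤ {A} {B} indep-A indep-B unaddable with
    bridge-bound (B ─ A) (⊂-wellFounded _) (proj₁ ∘ indep-A) S⊆∁A (unaddable⇒bridges indep-A unaddable)
    where
    S⊆∁A : B ─ A ⊆ ∁ A
    S⊆∁A = x∉p⇒x∈∁p ∘ x∈p─q⇒x∉q B A
  ... | K , D , sep , many = ∣B─A∣≤∣A─B∣⇒∣B∣≤∣A∣ A B (+-cancelʳ-≤ k (∣ B ─ A ∣) (∣ A ─ B ∣) (≤-trans many few))
    where
    ∁B⊆ : ∁ B ⊆ (∁ A ─ (B ─ A)) ∪ (A ─ B)
    ∁B⊆ {e} e∈∁B with e ∈? A
    ... | yes e∈A = x∈p∪q⁺ (inj₂ (x∈p∧x∉q⇒x∈p─q e∈A (x∈∁p⇒x∉p e∈∁B)))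
    ... | no e∉A = x∈p∪q⁺ (inj₁ (x∈p∧x∉q⇒x∈p─q (x∉p⇒x∈∁p e∉A) (x∈∁p⇒x∉p e∈∁B ∘ p─q⊆p B A)))

    few : K ≤ ∣ A ─ B ∣ + k
    few = spanning-bound (A ─ B) (⊂-wellFounded _) (spanning-mono ∁B⊆ (indep⇒spanning indep-B)) sep

  exchange : ∀ A B → Indep A → Indep B → ∣ A ∣ < ∣ B ∣ → ∃ λ e → e ∈ B × e ∉ A × Indep (A ∪ ⁅ e ⁆)
  exchange A B indep-A indep-B ∣A∣<∣B∣ with any? (λ e → e ∈? B ×-dec ¬? (e ∈? A) ×-dec indep? (A ∪ ⁅ e ⁆))
  ... | yes addable = addable
  ... | no none = contradiction (unaddable⇒≤ indep-A indep-B unaddable) (<⇒≱ ∣A∣<∣B∣)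
    where
    unaddable : ∀ s → s ∈ B ─ A → ¬ Indep (A ∪ ⁅ s ⁆)
    unaddable s s∈B─A indep = none (s , p─q⊆p B A s∈B─A , x∈p─q⇒x∉q B A s∈B─A , indep)

proposition4p3 : ∀ {n m k : ℕ} (G : SimpleGraph n m) (C : Fin k → Subset n) →
    (∀ i j → i ≢ j → Empty (E[_] G (C i) ∩ E[_] G (C j))) →
    (∀ i → Connected G (C i) (E[_] G (C i))) →
    IsMatroid m (λ W → ∀ i → Connected G (C i) (E[_] G (C i) ∩ ∁ (W ∩ E[_] G (C i))))
proposition4p3 G C disjoint connected = record
  { empty-indep = λ i → connected-mono (λ e∈Ei → kept⁺ e∈Ei ∉⊥) (connected i)
  ; hereditary  = λ A B B⊆A → indep-anti B⊆A
  ; exchange    = exchange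
  }
  where
  open Walks G
  open Deletion G C disjoint
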